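{- If some run of the global caching algorithm without intermediate propagation steps is successful (returns `Yes') on input $\phi_0$, then all runs on input $\phi_0$ are successful.
   Context: Setting: formulas of the alternation-free modal $\mu$-calculus $\psi,\phi ::= \bot \mid \top \mid p \mid \neg p \mid X \mid \psi\wedge\phi \mid \psi\vee\phi \mid \langle a \rangle\psi \mid [a]\psi \mid \mu X.\,\psi \mid \nu X.\,\psi$, assumed guarded, clean and irredundant. Tableau rules (premise / conclusions): $(\bot)$: $\Gamma,\bot$ / no conclusion; (clash): $\Gamma,p,\neg p$ / no conclusion; $(\wedge)$: $\Gamma,\psi\wedge\phi$ / $\Gamma,\psi,\phi$; $(\vee)$: $\Gamma,\psi\vee\phi$ / $\Gamma,\psi$ and $\Gamma,\phi$; $(\langle a\rangle)$: $\Gamma,[a]\psi_1,\ldots,[a]\psi_n,\langle a\rangle\phi$ / $\psi_1,\ldots,\psi_n,\phi$; $(\eta)$: $\Gamma,\eta X.\,\psi$ / $\Gamma,\psi[X\mapsto\eta X.\,\psi]$. $\mathcal{R}_m$ = modal rules, $\mathcal{R}_p$ = the rest. Nodes are subsets of the Fischer–Ladner closure of $\phi_0$; state nodes contain only $\top$, non-clashing propositional literals and modal literals; $\mathrm{concl}(\Delta)$ is the set of conclusion sets of rules from $\mathcal{R}_m$ (state node) or $\mathcal{R}_p$ (otherwise) with premise $\Delta$. Focused nodes $(\Gamma,d)$ with $d\subseteq\Gamma$ a set of deferrals; $d(\Gamma)$ is the set of all deferrals in $\Gamma$; $\mathbf{C}_G$ = focused nodes with label in $G$. $d_{\Delta\leadsto\Gamma}$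 = deferrals obtained by tracking $d$ from $\Delta$ to conclusion $\Gamma$, $\emptyset_{\Delta\leadsto\Gamma}=d(\Gamma)$. $f(Y)=\{(\Delta,d)\mid \forall \Sigma\in\mathrm{concl}(\Delta).\,\exists\Gamma\in\Sigma.\,(\Gamma,d_{\Delta\leadsto\Gamma})\in Y\}$, $g(Y)=\{(\Delta,d)\mid \exists \Sigma\in\mathrm{concl}(\Delta).\,\forall\Gamma\in\Sigma.\,(\Gamma,d_{\Delta\leadsto\Gamma})\in Y\}$; $F$/$\overline{F}$ = focused nodes with empty/nonempty focus; $\hat{f}_X(Y)=(f(Y)\cap\overline{F})\cup(f(X)\cap F)$, $\hat{g}_X(Y)=(g(Y)\cup F)\cap(g(X)\cup\overline{F})$; $E_G=\nu X.\mu Y.\,\hat{f}_X(Y)$, $A_G=\mu X.\nu Y.\,\hat{g}_X(Y)$ over base set $\mathbf{C}_G$. The global caching algorithm on closed $\phi_0$: (1) $G:=\emptyset$, $\Gamma_0:=\{\phi_0\}$, $U:=\{\Gamma_0\}$; (2) expansion: pick $t\in U$, set $G:=G\cup\{t\}$, $U:=(U-\{t\})\cup(\bigcup\mathrm{concl}(t)-G)$; (3) optional intermediate propagation: compute $E_G$ and/or $A_G$; if $(\Gamma_0,d(\Gamma_0))\in E_G$ return `Yes', if $(\Gamma_0,d(\Gamma_0))\in A_G$ return `No'; (4) if $U\neq\emptyset$ go to (2); (5) final propagation: compute $E_G$, return `Yes' iff $(\Gamma_0,d(\Gamma_0))\in E_G$. -}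

module Defs where

open import Level using (0ℓ)
open import Data.Nat using (ℕ; _≡ᵇ_)
open import Data.Bool using (Bool; true; false; if_then_else_)
open import Data.Fin using (Fin; zero; suc)
open import Data.List using (List; []; _∷_; _++_; length)
import Data.List as List
import Data.Vec as Vec
open import Data.List.Relation.Unary.Unique.Propositional using (Unique)
import Data.List.Membership.Propositional as LM
open import Data.Fin.Subset using (Subset)
open import Data.Product using (Σ; ∃; ∃-syntax; _×_; _,_; proj₁; proj₂)
open import Data.Sum using (_⊎_)
open import Data.Empty using (⊥)
open import Relation.Nullary using (¬_)
open import Relation.Binary.PropositionalEquality using (_≡_; _≢_)
open import Relation.Unary using (Pred; _⊆_)
open import Function.Bundles using (_⇔_)

-- Syntax of the (alternation-free) modal mu-calculus, in negation normal
-- form.  Propositional atoms, actions and fixpoint variables are named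
-- by natural numbers.

data Fm : Set where
  fls tru : Fm
  pos neg : ℕ → Fm
  var     : ℕ → Fm
  and or  : Fm → Fm → Fm
  dia box : ℕ → Fm → Fm
  mu nu   : ℕ → Fm → Fm

-- Substitution ψ[X ↦ θ] (capture is not an issue for clean formulas).
subst : ℕ → Fm → Fm → Fm
subst X θ fls = fls
subst X θ tru = tru
subst X θ (pos p) = pos p
subst X θ (neg p) = neg p
subst X θ (var Y) = if X ≡ᵇ Y then θ else var Y
subst X θ (and a b) = and (subst X θ a) (subst X θ b)
subst X θ (or a b) = or (subst X θ a) (subst X θ b)
subst X θ (dia c a) = dia c (subst X θ a)
subst X θ (box c a) = box c (subst X θ a)
subst X θ (mu Y a) = if X ≡ᵇ Y then mu Y a else mu Y (subst X θ a)
subst X θ (nu Y a) = if X ≡ᵇ Y then nu Y a else nu Y (subst X θ a)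

data _⊑_ (ψ : Fm) : Fm → Set where
  ⊑-refl : ψ ⊑ ψ
  ⊑-andl : ∀ {a b} → ψ ⊑ a → ψ ⊑ and a b
  ⊑-andr : ∀ {a b} → ψ ⊑ b → ψ ⊑ and a b
  ⊑-orl  : ∀ {a b} → ψ ⊑ a → ψ ⊑ or a b
  ⊑-orr  : ∀ {a b} → ψ ⊑ b → ψ ⊑ or a b
  ⊑-dia  : ∀ {c a} → ψ ⊑ a → ψ ⊑ dia c a
  ⊑-box  : ∀ {c a} → ψ ⊑ a → ψ ⊑ box c a
  ⊑-mu   : ∀ {Y a} → ψ ⊑ a → ψ ⊑ mu Y a
  ⊑-nu   : ∀ {Y a} → ψ ⊑ a → ψ ⊑ nu Y a

data FreeIn (X : ℕ) : Fm → Set where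
  fr-var  : FreeIn X (var X)
  fr-andl : ∀ {a b} → FreeIn X a → FreeIn X (and a b)
  fr-andr : ∀ {a b} → FreeIn X b → FreeIn X (and a b)
  fr-orl  : ∀ {a b} → FreeIn X a → FreeIn X (or a b)
  fr-orr  : ∀ {a b} → FreeIn X b → FreeIn X (or a b)
  fr-dia  : ∀ {c a} → FreeIn X a → FreeIn X (dia c a)
  fr-box  : ∀ {c a} → FreeIn X a → FreeIn X (box c a)
  fr-mu   : ∀ {Y a} → Y ≢ X → FreeIn X a → FreeIn X (mu Y a)
  fr-nu   : ∀ {Y a} → Y ≢ X → FreeIn X a → FreeIn X (nu Y a)

binders : Fm → List ℕ
binders fls = []
binders tru = []
binders (pos p) = []
binders (neg p) = []
binders (var Y) = []
binders (and a b) = binders a ++ binders b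
binders (or a b) = binders a ++ binders b
binders (dia c a) = binders a
binders (box c a) = binders a
binders (mu Y a) = Y ∷ binders a
binders (nu Y a) = Y ∷ binders a

Closed : Fm → Set
Closed φ = ∀ X → ¬ FreeIn X φ

Clean : Fm → Set
Clean φ = Unique (binders φ) × (∀ X → FreeIn X φ → ¬ (X LM.∈ binders φ))

data GuardedIn (X : ℕ) : Fm → Set where
  g-fls : GuardedIn X fls
  g-tru : GuardedIn X tru
  g-pos : ∀ {p} → GuardedIn X (pos p)
  g-neg : ∀ {p} → GuardedIn X (neg p)
  g-var : ∀ {Y} → Y ≢ X → GuardedIn X (var Y)
  g-and : ∀ {a b} → GuardedIn X a → GuardedIn X b → GuardedIn X (and a b)
  g-or  : ∀ {a b} → GuardedIn X a → GuardedIn X b → GuardedIn X (or a b)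
  g-dia : ∀ {c a} → GuardedIn X (dia c a)
  g-box : ∀ {c a} → GuardedIn X (box c a)
  g-mu= : ∀ {a} → GuardedIn X (mu X a)
  g-nu= : ∀ {a} → GuardedIn X (nu X a)
  g-mu  : ∀ {Y a} → Y ≢ X → GuardedIn X a → GuardedIn X (mu Y a)
  g-nu  : ∀ {Y a} → Y ≢ X → GuardedIn X a → GuardedIn X (nu Y a)

Guarded : Fm → Set
Guarded φ = ∀ X ψ → (mu X ψ ⊑ φ → GuardedIn X ψ) × (nu X ψ ⊑ φ → GuardedIn X ψ)

Irredundant : Fm → Set
Irredundant φ = ∀ X ψ → (mu X ψ ⊑ φ → FreeIn X ψ) × (nu X ψ ⊑ φ → FreeIn X ψ)

AltFree : Fm → Set
AltFree φ = ∀ X ψ Y θ → (mu X ψ ⊑ φ → nu Y θ ⊑ ψ → ¬ FreeIn X θ)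
                       × (nu X ψ ⊑ φ → mu Y θ ⊑ ψ → ¬ FreeIn X θ)

data FL (φ0 : Fm) : Fm → Set where
  fl-base : FL φ0 φ0
  fl-andl : ∀ {a b} → FL φ0 (and a b) → FL φ0 a
  fl-andr : ∀ {a b} → FL φ0 (and a b) → FL φ0 b
  fl-orl  : ∀ {a b} → FL φ0 (or a b) → FL φ0 a
  fl-orr  : ∀ {a b} → FL φ0 (or a b) → FL φ0 b
  fl-dia  : ∀ {c a} → FL φ0 (dia c a) → FL φ0 a
  fl-box  : ∀ {c a} → FL φ0 (box c a) → FL φ0 a
  fl-mu   : ∀ {X a} → FL φ0 (mu X a) → FL φ0 (subst X (mu X a) a)
  fl-nu   : ∀ {X a} → FL φ0 (nu X a) → FL φ0 (subst X (nu X a) a)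

-- Deferrals: χ = ψσ with σ = [X1 ↦ μX1.ψ1];…;[Xn ↦ μXn.ψn], n ≥ 1,
-- ψ a subformula of ψn with Xn free in ψ.  The substitutions are applied
-- innermost first: first [Xn ↦ μXn.ψn], then the list σ (which lists
-- (X_{n-1},ψ_{n-1}), …, (X1,ψ1) in this order).
applySeq : List (ℕ × Fm) → Fm → Fm
applySeq [] θ = θ
applySeq ((X , ψ) ∷ σ) θ = applySeq σ (subst X (mu X ψ) θ)

Deferral : Fm → Set
Deferral χ = ∃[ X ] ∃[ ψn ] ∃[ σ ] ∃[ ψ ]
  (ψ ⊑ ψn × FreeIn X ψ × χ ≡ applySeq ((X , ψn) ∷ σ) ψ)

-- Tableau, propagation and the global caching algorithm.
-- L is a duplicate-free enumeration of the Fischer–Ladner closure of φ0;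
-- nodes are subsets of FL(φ0), represented as Subset (length L).

module Tableau (φ0 : Fm) (L : List Fm) where

  n : ℕ
  n = length L

  Node : Set
  Node = Subset n

  at : Fin n → Fm
  at = List.lookup L

  _∈?_ : Fin n → Node → Set
  j ∈? Γ = Vec.lookup Γ j ≡ true

  _∈N_ : Fm → Node → Set
  χ ∈N Δ = ∃[ i ] (at i ≡ χ × i ∈? Δ)

  data StateFm : Fm → Set where
    s-tru : StateFm tru
    s-pos : ∀ {p} → StateFm (pos p)
    s-neg : ∀ {p} → StateFm (neg p)
    s-dia : ∀ {c a} → StateFm (dia c a)
    s-box : ∀ {c a} → StateFm (box c a)

  IsState : Node → Set
  IsState Δ = (∀ i → i ∈? Δ → StateFm (at i))
            × (∀ p → pos p ∈N Δ → neg p ∈N Δ → ⊥)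

  -- rule instances, identified by rule and principal formula
  data Inst : Set where
    r-fls   : Inst
    r-clash : ℕ → Inst
    r-and   : Fm → Fm → Inst
    r-or    : Fm → Fm → Inst
    r-mu    : ℕ → Fm → Inst
    r-nu    : ℕ → Fm → Inst
    r-dia   : ℕ → Fm → Inst

  arity : Inst → ℕ
  arity r-fls = 0
  arity (r-clash p) = 0
  arity (r-and a b) = 1
  arity (r-or a b) = 2
  arity (r-mu X a) = 1
  arity (r-nu X a) = 1
  arity (r-dia c a) = 1

  Applicable : Node → Inst → Set
  Applicable Δ r-fls = ¬ IsState Δ × fls ∈N Δ
  Applicable Δ (r-clash p) = ¬ IsState Δ × pos p ∈N Δ × neg p ∈N Δ
  Applicable Δ (r-and a b) = ¬ IsState Δ × and a b ∈N Δ
  Applicable Δ (r-or a b) = ¬ IsState Δ × or a b ∈N Δ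
  Applicable Δ (r-mu X a) = ¬ IsState Δ × mu X a ∈N Δ
  Applicable Δ (r-nu X a) = ¬ IsState Δ × nu X a ∈N Δ
  Applicable Δ (r-dia c a) = IsState Δ × dia c a ∈N Δ

  Rest : Node → Fm → Fm → Set
  Rest Δ π χ = χ ∈N Δ × χ ≢ π

  InConcl : (Δ : Node) (ι : Inst) → Fin (arity ι) → Fm → Set
  InConcl Δ r-fls ()
  InConcl Δ (r-clash p) ()
  InConcl Δ (r-and a b) zero χ = Rest Δ (and a b) χ ⊎ χ ≡ a ⊎ χ ≡ b
  InConcl Δ (r-or a b) zero χ = Rest Δ (or a b) χ ⊎ χ ≡ a
  InConcl Δ (r-or a b) (suc zero) χ = Rest Δ (or a b) χ ⊎ χ ≡ b
  InConcl Δ (r-mu X a) zero χ = Rest Δ (mu X a) χ ⊎ χ ≡ subst X (mu X a) a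
  InConcl Δ (r-nu X a) zero χ = Rest Δ (nu X a) χ ⊎ χ ≡ subst X (nu X a) a
  InConcl Δ (r-dia c a) zero χ = χ ≡ a ⊎ box c χ ∈N Δ

  Concl : (Δ : Node) (ι : Inst) → Fin (arity ι) → Node → Set
  Concl Δ ι k Γ = ∀ j → (j ∈? Γ ⇔ InConcl Δ ι k (at j))

  -- tracking of a formula χ of the premise to a formula χ' of the k-th
  -- conclusion of the instance ι
  Tr : (ι : Inst) → Fin (arity ι) → Fm → Fm → Set
  Tr r-fls ()
  Tr (r-clash p) ()
  Tr (r-and a b) zero χ χ' =
    (χ ≢ and a b × χ' ≡ χ) ⊎ (χ ≡ and a b × (χ' ≡ a ⊎ χ' ≡ b))
  Tr (r-or a b) zero χ χ' = (χ ≢ or a b × χ' ≡ χ) ⊎ (χ ≡ or a b × χ' ≡ a)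
  Tr (r-or a b) (suc zero) χ χ' = (χ ≢ or a b × χ' ≡ χ) ⊎ (χ ≡ or a b × χ' ≡ b)
  Tr (r-mu X a) zero χ χ' =
    (χ ≢ mu X a × χ' ≡ χ) ⊎ (χ ≡ mu X a × χ' ≡ subst X (mu X a) a)
  Tr (r-nu X a) zero χ χ' =
    (χ ≢ nu X a × χ' ≡ χ) ⊎ (χ ≡ nu X a × χ' ≡ subst X (nu X a) a)
  Tr (r-dia c a) zero χ χ' = (χ ≡ dia c a × χ' ≡ a) ⊎ χ ≡ box c χ'

  EmptyF : Node → Set
  EmptyF d = ∀ j → Vec.lookup d j ≡ false

  NonemptyF : Node → Set
  NonemptyF d = ∃[ j ] j ∈? d

  -- d' = d_{Δ⇝Γ} (for the k-th conclusion Γ of instance ι); if d is empty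
  -- then d' = d(Γ)
  Track : (ι : Inst) → Fin (arity ι) → (Γ d d' : Node) → Set
  Track ι k Γ d d' = ∀ j → (j ∈? d' ⇔
    (j ∈? Γ × Deferral (at j) × (EmptyF d ⊎ ∃[ i ] (i ∈? d × Tr ι k (at i) (at j)))))

  AllDef : Node → Node → Set
  AllDef Γ d = ∀ j → (j ∈? d ⇔ (j ∈? Γ × Deferral (at j)))

  FN : Set
  FN = Node × Node

  C : Pred Node 0ℓ → Pred FN 0ℓ
  C G (Γ , d) = G Γ × (∀ j → j ∈? d → j ∈? Γ) × (∀ j → j ∈? d → Deferral (at j))

  f : Pred Node 0ℓ → Pred FN 0ℓ → Pred FN 0ℓ
  f G Y (Δ , d) = ∀ ι → Applicable Δ ι → ∃[ k ] ∃[ Γ ] ∃[ d' ]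
    (Concl Δ ι k Γ × Track ι k Γ d d' × C G (Γ , d') × Y (Γ , d'))

  g : Pred Node 0ℓ → Pred FN 0ℓ → Pred FN 0ℓ
  g G Y (Δ , d) = ∃[ ι ] (Applicable Δ ι × (∀ k → ∃[ Γ ] ∃[ d' ]
    (Concl Δ ι k Γ × Track ι k Γ d d' × C G (Γ , d') × Y (Γ , d'))))

  fhat : Pred Node 0ℓ → Pred FN 0ℓ → Pred FN 0ℓ → Pred FN 0ℓ
  fhat G X Y x = C G x × ((f G Y x × NonemptyF (proj₂ x)) ⊎ (f G X x × EmptyF (proj₂ x)))

  ghat : Pred Node 0ℓ → Pred FN 0ℓ → Pred FN 0ℓ → Pred FN 0ℓ
  ghat G X Y x = C G x × (g G Y x ⊎ EmptyF (proj₂ x)) × (g G X x ⊎ NonemptyF (proj₂ x))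

  -- E_G = νX. μY. fhat_X(Y)   (Knaster–Tarski)
  E : Pred Node 0ℓ → FN → Set₁
  E G x = ∃[ X ] (X ⊆ (λ z → ∀ (Y : Pred FN 0ℓ) → fhat G X Y ⊆ Y → Y z) × X x)

  -- A_G = μX. νY. ghat_X(Y)   (Knaster–Tarski)
  A : Pred Node 0ℓ → FN → Set₁
  A G x = ∀ (X : Pred FN 0ℓ) →
    (λ z → ∃[ Y ] (Y ⊆ ghat G X Y × Y z)) ⊆ X → X x

  IsRoot : Node → Set
  IsRoot Γ = ∀ j → (j ∈? Γ ⇔ at j ≡ φ0)

  RootIn : (FN → Set₁) → Set₁
  RootIn P = ∃[ Γ0 ] ∃[ d0 ] (IsRoot Γ0 × AllDef Γ0 d0 × P (Γ0 , d0))

  Succ : Node → Node → Set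
  Succ t Γ = ∃[ ι ] (Applicable t ι × ∃[ k ] Concl t ι k Γ)

  -- The flag b says whether intermediate
  -- propagation is allowed.  'Run b G U r': at step (2) with state (G,U) the
  -- run can end with result r (true = Yes, false = No).  'After b G U r':
  -- the same, at step (3) right after an expansion.
  mutual
    data Run (b : Bool) : Pred Node 0ℓ → Pred Node 0ℓ → Bool → Set₁ where
      expand : ∀ {G U r} (t : Node) → U t →
        After b (λ Γ → G Γ ⊎ Γ ≡ t)
                (λ Γ → (U Γ × Γ ≢ t) ⊎ (Succ t Γ × ¬ (G Γ ⊎ Γ ≡ t))) r →
        Run b G U r

    data After (b : Bool) : Pred Node 0ℓ → Pred Node 0ℓ → Bool → Set₁ where
      inter-yes : ∀ {G U} → b ≡ true → RootIn (E G) → After b G U true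
      inter-no  : ∀ {G U} → b ≡ true → RootIn (A G) → After b G U false
      continue  : ∀ {G U r} → (∃[ Γ ] U Γ) → Run b G U r → After b G U r
      final-yes : ∀ {G U} → (∀ Γ → ¬ U Γ) → RootIn (E G) → After b G U true
      final-no  : ∀ {G U} → (∀ Γ → ¬ U Γ) → ¬ RootIn (E G) → After b G U false

  RunsTo : Bool → Bool → Set₁
  RunsTo b r = Run b (λ _ → ⊥) IsRoot r

module Submission where

open import Defs
open import Data.Bool using (Bool; true; false)
open import Data.List using (List)
open import Data.List.Relation.Unary.Unique.Propositional using (Unique)
import Data.List.Membership.Propositional as LM
open import Function.Bundles using (_⇔_)
open import Relation.Binary.PropositionalEquality using (_≡_)

open import Level using (0ℓ)
import Data.Bool.Properties as Bool
open import Data.Fin using (Fin)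
open import Data.Fin.Subset.Properties using (⊆-antisym)
open import Data.Vec.Properties using (≡-dec; lookup⇒[]=; []=⇒lookup)
open import Data.Product using (∃-syntax; _×_; _,_; proj₂)
open import Data.Sum using (_⊎_; inj₁; inj₂)
open import Data.Empty using (⊥; ⊥-elim)
open import Function.Bundles using (Equivalence)
open import Relation.Nullary using (¬_; Dec; yes; no)
open import Relation.Nullary.Decidable using (_⊎-dec_)
open import Relation.Binary.PropositionalEquality using (_≢_; refl; sym; trans)
open import Relation.Unary using (Pred; _⊆_; _≬_)

-- A successful run without intermediate propagation ends with a final
-- propagation on some G₁ consisting of reachable nodes, with the root in E_G₁.
-- A run answering No either finds the root in A_G at an intermediate step, or
-- stops once G contains every reachable node, with the root not in E_G.  The
-- first case is impossible because A_G and E_G' are always disjoint (f and g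
-- are dual, conclusions and tracked foci being uniquely determined); the
-- second contradicts the monotonicity of E in G, as G₁ ⊆ G.

module _ (φ0 : Fm) (L : List Fm) where
  open Tableau φ0 L

  Node-ext : {Γ Γ' : Node} → (∀ j → j ∈? Γ → j ∈? Γ') → (∀ j → j ∈? Γ' → j ∈? Γ) → Γ ≡ Γ'
  Node-ext Γ⊆Γ' Γ'⊆Γ =
    ⊆-antisym (λ {j} p → lookup⇒[]= j _ (Γ⊆Γ' j ([]=⇒lookup p)))
              (λ {j} p → lookup⇒[]= j _ (Γ'⊆Γ j ([]=⇒lookup p)))

  Node-unique : {Γ Γ' : Node} (P : Fin n → Set) →
    (∀ j → j ∈? Γ ⇔ P j) → (∀ j → j ∈? Γ' ⇔ P j) → Γ ≡ Γ'
  Node-unique P Γ⇔P Γ'⇔P =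
    Node-ext (λ j p → Equivalence.from (Γ'⇔P j) (Equivalence.to (Γ⇔P j) p))
             (λ j p → Equivalence.from (Γ⇔P j) (Equivalence.to (Γ'⇔P j) p))

  Concl-unique : ∀ {Δ ι k Γ Γ'} → Concl Δ ι k Γ → Concl Δ ι k Γ' → Γ ≡ Γ'
  Concl-unique {Δ} {ι} {k} = Node-unique (λ j → InConcl Δ ι k (at j))

  Track-unique : ∀ {ι k Γ d d₁ d₂} → Track ι k Γ d d₁ → Track ι k Γ d d₂ → d₁ ≡ d₂
  Track-unique = Node-unique _

  EmptyF⇒¬NonemptyF : ∀ {d} → EmptyF d → ¬ NonemptyF d
  EmptyF⇒¬NonemptyF empty (j , j∈d) with trans (sym (empty j)) j∈d
  ... | ()

  g∧f⇒≬ : ∀ {G G' P Q x} → g G P x → f G' Q x → P ≬ Q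
  g∧f⇒≬ {x = Δ , d} (ι , app , all-k) f-Q with f-Q ι app
  ... | k , Γ , d' , concl , track , _ , Q-Γd' with all-k k
  ... | Γ₂ , d₂ , concl₂ , track₂ , _ , P-Γd₂
    with refl ← Concl-unique {Δ} {ι} {k} {Γ} {Γ₂} concl concl₂
    with refl ← Track-unique {ι} {k} {Γ} {d} {d'} {d₂} track track₂ = (Γ , d') , P-Γd₂ , Q-Γd'

  -- The complement of a postfixed witness XE of E_G' is a prefixed point of
  -- X ↦ νY. ĝ_X(Y), since the complement of every ĝ-postfixed Y is f̂_XE-closed.
  A∩E-empty : ∀ {G G' x} → A G x → ¬ E G' x
  A∩E-empty {G} {G'} x∈A (XE , XE-post , x∈XE) = x∈A (λ z → ¬ XE z) ¬E-prefixed x∈XE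
    where
    ¬E-prefixed : (λ z → ∃[ Y ] (Y ⊆ ghat G (λ z → ¬ XE z) Y × Y z)) ⊆ (λ z → ¬ XE z)
    ¬E-prefixed (Y , Y-post , z∈Y) z∈XE = XE-post z∈XE (λ w → ¬ Y w) ¬Y-closed z∈Y
      where
      ¬Y-closed : fhat G' XE (λ w → ¬ Y w) ⊆ (λ w → ¬ Y w)
      ¬Y-closed {w} (_ , f̂) w∈Y with Y-post w∈Y | f̂
      ... | _ , inj₁ g-Y , _ | inj₁ (f-¬Y , _) with _ , y , ¬y ← g∧f⇒≬ {x = w} g-Y f-¬Y = ¬y y
      ... | _ , inj₂ empty , _ | inj₁ (_ , nonempty) = EmptyF⇒¬NonemptyF {proj₂ w} empty nonempty
      ... | _ , _ , inj₁ g-¬XE | inj₂ (f-XE , _) with _ , ¬e , e ← g∧f⇒≬ {x = w} g-¬XE f-XE = ¬e e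
      ... | _ , _ , inj₂ nonempty | inj₂ (_ , empty) = EmptyF⇒¬NonemptyF {proj₂ w} empty nonempty

  RootIn-unique : ∀ {P Q : FN → Set₁} → RootIn P → RootIn Q → ∃[ x ] (P x × Q x)
  RootIn-unique (Γ₀ , d₀ , root₀ , defs₀ , P-x) (Γ₁ , d₁ , root₁ , defs₁ , Q-x)
    with refl ← Node-unique {Γ₀} {Γ₁} _ root₀ root₁
    with refl ← Node-unique {d₀} {d₁} _ defs₀ defs₁ = (Γ₀ , d₀) , P-x , Q-x

  RootIn-A∩E-empty : ∀ {G G'} → RootIn (A G) → ¬ RootIn (E G')
  RootIn-A∩E-empty rA rE with _ , x∈A , x∈E ← RootIn-unique rA rE = A∩E-empty x∈A x∈E

  C-mono : ∀ {G G'} → G ⊆ G' → C G ⊆ C G'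
  C-mono G⊆G' {Γ , d} (Γ∈G , d⊆Γ , d-defs) = G⊆G' {Γ} Γ∈G , d⊆Γ , d-defs

  f-mono : ∀ {G G' Y} → G ⊆ G' → f G Y ⊆ f G' Y
  f-mono {G} {G'} G⊆G' f-Y ι app with f-Y ι app
  ... | k , Γ , d' , concl , track , c , y =
    k , Γ , d' , concl , track , C-mono {G} {G'} G⊆G' {Γ , d'} c , y

  fhat-mono : ∀ {G G' X Y} → G ⊆ G' → fhat G X Y ⊆ fhat G' X Y
  fhat-mono {G} {G'} G⊆G' {x} (c , inj₁ (f-Y , ne)) =
    C-mono {G} {G'} G⊆G' {x} c , inj₁ (f-mono G⊆G' {x} f-Y , ne)
  fhat-mono {G} {G'} G⊆G' {x} (c , inj₂ (f-X , e)) =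
    C-mono {G} {G'} G⊆G' {x} c , inj₂ (f-mono G⊆G' {x} f-X , e)

  E-mono : ∀ {G G'} → G ⊆ G' → ∀ {x} → E G x → E G' x
  E-mono G⊆G' (X , X-post , x∈X) =
    X , (λ z∈X Y Y-pre → X-post z∈X Y (λ {w} p → Y-pre (fhat-mono G⊆G' {w} p))) , x∈X

  RootIn-E-mono : ∀ {G G'} → G ⊆ G' → RootIn (E G) → RootIn (E G')
  RootIn-E-mono G⊆G' (Γ₀ , d₀ , is-root , defs , e) = Γ₀ , d₀ , is-root , defs , E-mono G⊆G' e

  data Reachable : Node → Set where
    root : ∀ {Γ} → IsRoot Γ → Reachable Γ
    succ : ∀ {t Γ} → Reachable t → Succ t Γ → Reachable Γ

  -- The expanded set G is tracked decidably because the new frontier after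
  -- expanding t is only specified as the successors of t lying outside G ∪ {t}.
  record RunInvariant (G U : Pred Node 0ℓ) : Set where
    field
      G-dec        : ∀ Γ → Dec (G Γ)
      root-covered : ∀ Γ → IsRoot Γ → G Γ ⊎ U Γ
      succ-covered : ∀ s Γ → G s → Succ s Γ → G Γ ⊎ U Γ
      G-reachable  : ∀ Γ → G Γ → Reachable Γ
      U-reachable  : ∀ Γ → U Γ → Reachable Γ

  RunInvariant-initial : RunInvariant (λ _ → ⊥) IsRoot
  RunInvariant-initial = record
    { G-dec = λ _ → no λ ()
    ; root-covered = λ _ r → inj₂ r
    ; succ-covered = λ _ _ ()
    ; G-reachable = λ _ ()
    ; U-reachable = λ _ r → root r
    }

  RunInvariant-expand : ∀ {G U} (t : Node) → U t → RunInvariant G U →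
    RunInvariant (λ Γ → G Γ ⊎ Γ ≡ t)
                 (λ Γ → (U Γ × Γ ≢ t) ⊎ (Succ t Γ × ¬ (G Γ ⊎ Γ ≡ t)))
  RunInvariant-expand {G} {U} t t∈U I = record
    { G-dec = G'-dec
    ; root-covered = λ Γ r → covered Γ (root-covered Γ r)
    ; succ-covered = succ-covered'
    ; G-reachable = G'-reachable
    ; U-reachable = U'-reachable
    }
    where
    open RunInvariant I
    G'-dec : ∀ Γ → Dec (G Γ ⊎ Γ ≡ t)
    G'-dec Γ = G-dec Γ ⊎-dec ≡-dec Bool._≟_ Γ t
    covered : ∀ Γ → G Γ ⊎ U Γ →
      (G Γ ⊎ Γ ≡ t) ⊎ ((U Γ × Γ ≢ t) ⊎ (Succ t Γ × ¬ (G Γ ⊎ Γ ≡ t)))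
    covered Γ (inj₁ Γ∈G) = inj₁ (inj₁ Γ∈G)
    covered Γ (inj₂ Γ∈U) with ≡-dec Bool._≟_ Γ t
    ... | yes Γ≡t = inj₁ (inj₂ Γ≡t)
    ... | no Γ≢t = inj₂ (inj₁ (Γ∈U , Γ≢t))
    succ-covered' : ∀ s Γ → G s ⊎ s ≡ t → Succ s Γ →
      (G Γ ⊎ Γ ≡ t) ⊎ ((U Γ × Γ ≢ t) ⊎ (Succ t Γ × ¬ (G Γ ⊎ Γ ≡ t)))
    succ-covered' s Γ (inj₁ s∈G) s→Γ = covered Γ (succ-covered s Γ s∈G s→Γ)
    succ-covered' s Γ (inj₂ refl) s→Γ with G'-dec Γ
    ... | yes Γ∈G' = inj₁ Γ∈G'
    ... | no Γ∉G' = inj₂ (inj₂ (s→Γ , Γ∉G'))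
    G'-reachable : ∀ Γ → G Γ ⊎ Γ ≡ t → Reachable Γ
    G'-reachable Γ (inj₁ Γ∈G) = G-reachable Γ Γ∈G
    G'-reachable Γ (inj₂ refl) = U-reachable t t∈U
    U'-reachable : ∀ Γ → (U Γ × Γ ≢ t) ⊎ (Succ t Γ × ¬ (G Γ ⊎ Γ ≡ t)) → Reachable Γ
    U'-reachable Γ (inj₁ (Γ∈U , _)) = U-reachable Γ Γ∈U
    U'-reachable Γ (inj₂ (t→Γ , _)) = succ (U-reachable t t∈U) t→Γ

  Reachable⊆G : ∀ {G U} → RunInvariant G U → (∀ Γ → ¬ U Γ) → ∀ Γ → Reachable Γ → G Γ
  Reachable⊆G {G} {U} I U-empty = go
    where
    open RunInvariant I
    in-G : ∀ {Γ} → G Γ ⊎ U Γ → G Γ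
    in-G (inj₁ Γ∈G) = Γ∈G
    in-G {Γ} (inj₂ Γ∈U) = ⊥-elim (U-empty Γ Γ∈U)
    go : ∀ Γ → Reachable Γ → G Γ
    go Γ (root r) = in-G (root-covered Γ r)
    go Γ (succ {t} reach t→Γ) = in-G (succ-covered t Γ (go t reach) t→Γ)

  SuccessWitness : Set₁
  SuccessWitness = ∃[ G ] ((∀ Γ → G Γ → Reachable Γ) × RootIn (E G))

  FailureWitness : Set₁
  FailureWitness = (∃[ G ] RootIn (A G))
                 ⊎ (∃[ G ] ((∀ Γ → Reachable Γ → G Γ) × ¬ RootIn (E G)))

  mutual
    Run-yes : ∀ {G U r} → RunInvariant G U → Run false G U r → r ≡ true → SuccessWitness
    Run-yes I (expand t t∈U after) = After-yes (RunInvariant-expand t t∈U I) after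

    After-yes : ∀ {G U r} → RunInvariant G U → After false G U r → r ≡ true → SuccessWitness
    After-yes I (inter-yes () _)
    After-yes I (inter-no () _)
    After-yes I (continue _ run) = Run-yes I run
    After-yes {G} I (final-yes _ rE) refl = G , RunInvariant.G-reachable I , rE
    After-yes I (final-no _ _) ()

  mutual
    Run-no : ∀ {b G U r} → RunInvariant G U → Run b G U r → r ≡ false → FailureWitness
    Run-no I (expand t t∈U after) = After-no (RunInvariant-expand t t∈U I) after

    After-no : ∀ {b G U r} → RunInvariant G U → After b G U r → r ≡ false → FailureWitness
    After-no I (inter-yes _ _) ()
    After-no I (inter-no _ rA) refl = inj₁ (_ , rA)
    After-no I (continue _ run) = Run-no I run
    After-no I (final-yes _ _) ()
    After-no {G = G} I (final-no U-empty ¬rE) refl = inj₂ (G , Reachable⊆G I U-empty , ¬rE)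

lemma16 : (φ0 : Fm) → Closed φ0 → Guarded φ0 → Clean φ0 → Irredundant φ0 → AltFree φ0 →
    (L : List Fm) → (∀ χ → FL φ0 χ ⇔ χ LM.∈ L) → Unique L →
    Tableau.RunsTo φ0 L false true →
    ∀ (b r : Bool) → Tableau.RunsTo φ0 L b r → r ≡ true
lemma16 φ0 _ _ _ _ _ L _ _ success b true run = refl
lemma16 φ0 _ _ _ _ _ L _ _ success b false run
  with G₁ , G₁-reachable , rE ← Run-yes φ0 L (RunInvariant-initial φ0 L) success refl
  with Run-no φ0 L (RunInvariant-initial φ0 L) run refl
... | inj₁ (_ , rA) = ⊥-elim (RootIn-A∩E-empty φ0 L rA rE)
... | inj₂ (_ , reachable⊆G , ¬rE) =
  ⊥-elim (¬rE (RootIn-E-mono φ0 L (λ {Γ} Γ∈G₁ → reachable⊆G Γ (G₁-reachable Γ Γ∈G₁)) rE))
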